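{- Let $q$ be an odd prime power, $m_1,n_1,m_2,n_2\in\{1,\dots,q-1\}$, and suppose $\phi\colon V(D(q;m_1,n_1))\to V(D(q;m_2,n_2))$, $\phi(x,y)=(f(x,y),g(x,y))$, is a digraph isomorphism, where $f,g\in\mathbb{F}_q[X,Y]$ have degree at most $q-1$ in each variable. Then: (i) $f$ and $g$ are permutation polynomials in two variables on $\mathbb{F}_q$; (ii) if $m_1\neq n_1$, then $f(x,y)=0$ if and only if $x=0$; (iii) if $m_1\neq n_1$, then $g$ is a polynomial in the indeterminate $Y$ only, of the form $g(Y)=a_{q-2}Y^{q-2}+a_{q-4}Y^{q-4}+\dots+a_1Y$ with all $a_i\in\mathbb{F}_q$ (only odd powers of $Y$ up to $q-2$ appear), and $g$ is a permutation polynomial on $\mathbb{F}_q$.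
   Context: $\mathbb{F}_q$ is the field with $q$ elements. For integers $1\le m,n\le q-1$, the monomial digraph $D(q;m,n)$ has vertex set $\mathbb{F}_q^2$, and $((x_1,x_2),(y_1,y_2))$ is an arc iff $x_2+y_2=x_1^m y_1^n$. A polynomial $h\in\mathbb{F}_q[X_1,\dots,X_n]$ is a permutation polynomial in $n$ variables on $\mathbb{F}_q$ if for each $\alpha\in\mathbb{F}_q$ the equation $h(x_1,\dots,x_n)=\alpha$ has exactly $q^{n-1}$ solutions in $\mathbb{F}_q^n$; for $n=1$ it is called a permutation polynomial on $\mathbb{F}_q$ (it induces a bijection of $\mathbb{F}_q$). -}

module Defs where

open import Level using (Level; _⊔_; suc)
open import Algebra.Bundles using (CommutativeRing)
open import Data.Nat as ℕ using (ℕ; zero; _∸_) renaming (suc to sucℕ)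
open import Data.Fin using (Fin; toℕ)
open import Data.List using (List; length; filter; allFin; foldr; map; cartesianProduct)
open import Data.List.Membership.Setoid using ()
open import Data.List.Relation.Unary.Any using (Any)
open import Data.List.Relation.Unary.AllPairs using (AllPairs)
open import Data.Product using (_×_; _,_; ∃; proj₁; proj₂)
open import Relation.Nullary using (¬_)
open import Relation.Binary using (Decidable)
open import Relation.Nullary.Decidable using (Dec)
open import Relation.Unary using (Pred)
open import Function.Bundles using (_⇔_)
open import Relation.Binary.PropositionalEquality using (_≡_)

record FiniteField (c ℓ : Level) : Set (suc (c ⊔ ℓ)) where
  field
    commRing : CommutativeRing c ℓ
  open CommutativeRing commRing public
  field
    1≉0      : ¬ (1# ≈ 0#)
    inverse  : ∀ x → ¬ (x ≈ 0#) → ∃ λ y → x * y ≈ 1#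
    _≟_      : Decidable _≈_
    elements : List Carrier
    complete : ∀ x → Any (x ≈_) elements
    distinct : AllPairs (λ x y → ¬ (x ≈ y)) elements

  size : ℕ
  size = length elements

module _ {c ℓ : Level} (F : FiniteField c ℓ) where
  open FiniteField F

  -- x ^ k for natural k (x ^ 0 = 1, including 0 ^ 0 = 1)
  pow : Carrier → ℕ → Carrier
  pow x zero     = 1#
  pow x (sucℕ k) = x * pow x k

  -- Polynomials in F_q[X,Y] of degree at most q-1 in each variable,
  -- given by their coefficients: coefficient (i , j) is that of X^i Y^j.
  Poly2 : Set c
  Poly2 = Fin size → Fin size → Carrier

  sumFin : ∀ {n} → (Fin n → Carrier) → Carrier
  sumFin {n} h = foldr _+_ 0# (map h (allFin n))

  eval2 : Poly2 → Carrier → Carrier → Carrier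
  eval2 p x y = sumFin (λ i → sumFin (λ j → p i j * (pow x (toℕ i) * pow y (toℕ j))))

  countSol : (Carrier → Carrier → Carrier) → Carrier → ℕ
  countSol h α = length (filter (λ xy → h (proj₁ xy) (proj₂ xy) ≟ α)
                                (cartesianProduct elements elements))

  -- permutation polynomial in two variables: each value taken q^(2-1) = q times
  IsPermPoly2 : Poly2 → Set c
  IsPermPoly2 p = ∀ α → countSol (eval2 p) α ≡ size

  IsBijection1 : (Carrier → Carrier) → Set (c ⊔ ℓ)
  IsBijection1 h = (∀ x y → h x ≈ h y → x ≈ y) × (∀ z → ∃ λ x → h x ≈ z)

  Vtx : Set c
  Vtx = Carrier × Carrier

  _≈V_ : Vtx → Vtx → Set ℓ
  (a , b) ≈V (a' , b') = (a ≈ a') × (b ≈ b')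

  Arc : ℕ → ℕ → Vtx → Vtx → Set ℓ
  Arc m n (x₁ , x₂) (y₁ , y₂) = (x₂ + y₂) ≈ (pow x₁ m * pow y₁ n)

  IsDigraphIso : ℕ → ℕ → ℕ → ℕ → (Vtx → Vtx) → Set (c ⊔ ℓ)
  IsDigraphIso m₁ n₁ m₂ n₂ φ =
    (∀ u v → φ u ≈V φ v → u ≈V v) ×
    (∀ w → ∃ λ u → φ u ≈V w) ×
    (∀ u v → Arc m₁ n₁ u v ⇔ Arc m₂ n₂ (φ u) (φ v))

  polyMap : Poly2 → Poly2 → Vtx → Vtx
  polyMap f g (x , y) = (eval2 f x y , eval2 g x y)

-- An isomorphism of digraphs maps symmetric vertices (u such that every arc u → v
-- is reversed by an arc v → u) to symmetric vertices.  In D(q; m, n) the vertices on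
-- the axis x = 0 are symmetric, and if m ≠ n no other vertex is: symmetry of (a, b)
-- forces a^m y^n = y^m a^n for every y, and a^m Y^n − a^n Y^m is a nonzero polynomial
-- of degree < q.  Hence f(x, y) = 0 exactly when x = 0.  The arc (0, −y) → (x, y) then
-- gives g(0, −y) + g(x, y) = 0, so g does not depend on x and is odd in y; comparing
-- coefficients (a polynomial of degree < q vanishing on F_q is zero, and 2 ≠ 0 since q
-- is odd) gives the shape of g.  Part (i) is a count: a bijection of F_q² preserves the
-- number of points whose first coordinate is α, which is q.

module Submission where

open import Level using (Level; _⊔_)
open import Defs
open import Function using (_∘_; id)
open import Function.Bundles using (Equivalence; _⇔_; mk⇔)
open import Data.Bool using (true; false)
open import Data.Empty using (⊥-elim)
open import Data.Nat as ℕ using (ℕ; zero; suc; _≤_; _<_; _∸_; z≤n; s≤s)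
import Data.Nat.Properties as ℕP
open import Data.Nat.Properties using (suc-injective; ≤-refl; <⇒≤pred; ≤∧≢⇒<)
open import Data.Nat.Divisibility using (_∣_; _∣?_; divides; _∣0; ∣m∣n⇒∣m+n; ∣-refl)
open import Data.Fin using (Fin; zero; suc; toℕ; fromℕ<; punchIn)
open import Data.Fin.Properties using (toℕ<n; punchInᵢ≢i; toℕ-fromℕ<; fromℕ<-injective)
open import Data.Product using (_×_; _,_; ∃; proj₁; proj₂; swap)
open import Data.Product.Relation.Binary.Pointwise.NonDependent using (_×ₛ_)
open import Data.Sum as Sum using (_⊎_; inj₁; inj₂)
open import Data.Vec.Functional as Vec using (Vector; head; tail)
open import Data.Vec.Functional.Properties using (updateAt-updates; updateAt-minimal)
import Data.List as List
open import Data.List using (List; []; _∷_; length; filter; map; cartesianProduct; _++_)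
open import Data.List.Properties
  using (map-tabulate; length-++; filter-++; filter-accept; filter-reject; filter-none; filter-all)
open import Data.List.Relation.Unary.Any using (here; there)
open import Data.List.Relation.Unary.All as All using (All; []; _∷_)
open import Data.List.Relation.Unary.AllPairs using ([]; _∷_)
import Data.List.Membership.Setoid as Membership
import Data.List.Membership.Setoid.Properties as MembershipP
import Data.List.Relation.Unary.Unique.Setoid as UniqueS
import Data.List.Relation.Unary.Unique.Setoid.Properties as UniqueP
import Data.List.Relation.Binary.Permutation.Setoid as Perm
import Data.List.Relation.Binary.Permutation.Setoid.Properties as PermP
open import Relation.Binary.Bundles using (Setoid)
open import Relation.Binary.Definitions using (Decidable)
open import Relation.Binary.PropositionalEquality as ≡ using (_≡_; _≢_)
open import Relation.Nullary using (¬_; Dec; yes; no; does)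
open import Relation.Nullary.Decidable using (decidable-stable)
open import Relation.Unary using (Pred) renaming (Decidable to Decidable₁)

private
  variable
    a b p : Level
    A : Set a
    B : Set b

length-filter-map : ∀ {P : Pred B p} (P? : Decidable₁ P) (f : A → B) xs →
                    length (filter (P? ∘ f) xs) ≡ length (filter P? (map f xs))
length-filter-map P? f []       = ≡.refl
length-filter-map P? f (x ∷ xs) with does (P? (f x))
... | true  = ≡.cong suc (length-filter-map P? f xs)
... | false = length-filter-map P? f xs

length-filter-proj₁-cartesianProduct : ∀ {P : Pred A p} (P? : Decidable₁ P) xs (ys : List B) →
  length (filter (P? ∘ proj₁) (cartesianProduct xs ys)) ≡ length (filter P? xs) ℕ.* length ys
length-filter-proj₁-cartesianProduct P? []       ys = ≡.refl
length-filter-proj₁-cartesianProduct {P = P} P? (x ∷ xs) ys = begin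
  length (filter P₁? (map (x ,_) ys ++ cartesianProduct xs ys))
    ≡⟨ ≡.cong length (filter-++ P₁? (map (x ,_) ys) _) ⟩
  length (filter P₁? (map (x ,_) ys) ++ filter P₁? (cartesianProduct xs ys))
    ≡⟨ length-++ (filter P₁? (map (x ,_) ys)) ⟩
  length (filter P₁? (map (x ,_) ys)) ℕ.+ length (filter P₁? (cartesianProduct xs ys))
    ≡⟨ ≡.cong₂ ℕ._+_ (≡.sym (length-filter-map P₁? (x ,_) ys))
                     (length-filter-proj₁-cartesianProduct P? xs ys) ⟩
  length (filter (λ _ → P? x) ys) ℕ.+ length (filter P? xs) ℕ.* length ys
    ≡⟨ row (P? x) ⟩
  length (filter P? (x ∷ xs)) ℕ.* length ys ∎
  where
  open ≡.≡-Reasoning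
  P₁? = P? ∘ proj₁
  row : Dec (P x) →
        length (filter (λ _ → P? x) ys) ℕ.+ length (filter P? xs) ℕ.* length ys
          ≡ length (filter P? (x ∷ xs)) ℕ.* length ys
  row (yes px) = ≡.trans (≡.cong (λ l → length l ℕ.+ _)
                                  (filter-all (λ _ → P? x) (All.universal (λ _ → px) ys)))
                         (≡.cong (λ l → length l ℕ.* length ys) (≡.sym (filter-accept P? px)))
  row (no ¬px) = ≡.trans (≡.cong (λ l → length l ℕ.+ _)
                                  (filter-none (λ _ → P? x) (All.universal (λ _ → ¬px) ys)))
                         (≡.cong (λ l → length l ℕ.* length ys) (≡.sym (filter-reject P? ¬px)))

module _ {c ℓ : Level} (S : Setoid c ℓ) where
  open Setoid S
  open Membership S using (_∈_)
  open UniqueS S using (Unique)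
  open Perm S using (_↭_; prep; ↭-refl; ↭-sym; ↭-trans) renaming (refl to ≋⇒↭)
  open PermP S using (shift; ∈-resp-↭; Unique-resp-↭; filter⁺; xs↭ys⇒|xs|≡|ys|)
  open MembershipP using (∈-∃++; ∈-resp-≈; All[≉]⇒∉)

  ∈⇒↭∷ : ∀ {x xs} → x ∈ xs → ∃ λ ys → xs ↭ x ∷ ys
  ∈⇒↭∷ x∈xs with ∈-∃++ S x∈xs
  ... | ys , zs , _ , x≈w , xs≋ = ys ++ zs , ↭-trans (≋⇒↭ xs≋) (shift (sym x≈w) ys zs)

  unique-⊆-⊇⇒↭ : ∀ {xs ys} → Unique xs → Unique ys →
                 (∀ {z} → z ∈ xs → z ∈ ys) → (∀ {z} → z ∈ ys → z ∈ xs) → xs ↭ ys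
  unique-⊆-⊇⇒↭ {[]}     {[]}    _ _ _ _ = ↭-refl
  unique-⊆-⊇⇒↭ {[]}     {_ ∷ _} _ _ _ ys⊆xs with ys⊆xs (here refl)
  ... | ()
  unique-⊆-⊇⇒↭ {x ∷ xs} {ys} (x∉xs ∷ !xs) !ys xs⊆ys ys⊆xs with ∈⇒↭∷ (xs⊆ys (here refl))
  ... | ys′ , ys↭x∷ys′ with Unique-resp-↭ ys↭x∷ys′ !ys
  ... | x∉ys′ ∷ !ys′ =
    ↭-trans (prep refl (unique-⊆-⊇⇒↭ !xs !ys′ xs⊆ys′ ys′⊆xs)) (↭-sym ys↭x∷ys′)
    where
    xs⊆ys′ : ∀ {z} → z ∈ xs → z ∈ ys′
    xs⊆ys′ z∈xs with ∈-resp-↭ ys↭x∷ys′ (xs⊆ys (there z∈xs))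
    ... | here z≈x   = ⊥-elim (All[≉]⇒∉ S x∉xs (∈-resp-≈ S z≈x z∈xs))
    ... | there z∈ys′ = z∈ys′
    ys′⊆xs : ∀ {z} → z ∈ ys′ → z ∈ xs
    ys′⊆xs z∈ys′ with ys⊆xs (∈-resp-↭ (↭-sym ys↭x∷ys′) (there z∈ys′))
    ... | here z≈x  = ⊥-elim (All[≉]⇒∉ S x∉ys′ (∈-resp-≈ S z≈x z∈ys′))
    ... | there z∈xs = z∈xs

  module _ (_≟_ : Decidable _≈_) where

    length-filter-≟-unique : ∀ {x xs} → Unique xs → x ∈ xs → length (filter (_≟ x) xs) ≡ 1
    length-filter-≟-unique {x} {xs} !xs x∈xs with ∈⇒↭∷ x∈xs
    ... | ys , xs↭x∷ys with Unique-resp-↭ xs↭x∷ys !xs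
    ... | x≉ys ∷ _ = begin
      length (filter (_≟ x) xs)        ≡⟨ xs↭ys⇒|xs|≡|ys| (filter⁺ (_≟ x) ≈-resp xs↭x∷ys) ⟩
      length (filter (_≟ x) (x ∷ ys))  ≡⟨ ≡.cong length (filter-accept (_≟ x) refl) ⟩
      suc (length (filter (_≟ x) ys))  ≡⟨ ≡.cong (suc ∘ length) (filter-none (_≟ x) (All.map (_∘ sym) x≉ys)) ⟩
      1                                ∎
      where
      open ≡.≡-Reasoning
      ≈-resp : ∀ {y z} → y ≈ z → y ≈ x → z ≈ x
      ≈-resp y≈z y≈x = trans (sym y≈z) y≈x

  module _ {P : Pred Carrier p} (P? : Decidable₁ P) (P-resp : ∀ {x y} → x ≈ y → P x → P y)
           (φ : Carrier → Carrier) (φ-cong : ∀ {x y} → x ≈ y → φ x ≈ φ y)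
           (φ-injective : ∀ x y → φ x ≈ φ y → x ≈ y) (φ-surjective : ∀ y → ∃ λ x → φ x ≈ y) where

    length-filter-∘-bijection : ∀ {xs} → Unique xs → (∀ x → x ∈ xs) →
                                length (filter (P? ∘ φ) xs) ≡ length (filter P? xs)
    length-filter-∘-bijection {xs} !xs complete = ≡.trans (length-filter-map P? φ xs)
      (xs↭ys⇒|xs|≡|ys| (filter⁺ P? P-resp (unique-⊆-⊇⇒↭ !φxs !xs (λ {z} _ → complete z) onto)))
      where
      !φxs : Unique (map φ xs)
      !φxs = UniqueP.map⁺ S S (λ {x} {y} → φ-injective x y) !xs
      onto : ∀ {z} → z ∈ xs → z ∈ map φ xs
      onto {z} _ with φ-surjective z
      ... | x , φx≈z = ∈-resp-≈ S φx≈z (MembershipP.∈-map⁺ S S φ-cong (complete x))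

  module _ (σ : Carrier → Carrier) (σ-cong : ∀ {x y} → x ≈ y → σ x ≈ σ y)
           (σ-involutive : ∀ x → σ (σ x) ≈ x) (σ-fixpoint-free : ∀ x → ¬ σ x ≈ x) where

    even-length-closed : ∀ n {xs} → length xs ≡ n → Unique xs → (∀ {x} → x ∈ xs → σ x ∈ xs) → 2 ∣ n
    even-length-closed zero _ _ _ = 2 ∣0
    even-length-closed (suc n) {x ∷ xs} |x∷xs| (x≉xs ∷ !xs) closed with closed (here refl)
    ... | here σx≈x   = ⊥-elim (σ-fixpoint-free x σx≈x)
    ... | there σx∈xs with ∈⇒↭∷ σx∈xs
    ... | ys , xs↭σx∷ys
      with Unique-resp-↭ xs↭σx∷ys !xs | n
         | ≡.trans (≡.sym (xs↭ys⇒|xs|≡|ys| xs↭σx∷ys)) (suc-injective |x∷xs|)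
    ... | σx≉ys ∷ !ys | suc n′ | |σx∷ys| =
      ∣m∣n⇒∣m+n ∣-refl (even-length-closed n′ (suc-injective |σx∷ys|) !ys closed-ys)
      where
      closed-ys : ∀ {z} → z ∈ ys → σ z ∈ ys
      closed-ys {z} z∈ys with closed (there (∈-resp-↭ (↭-sym xs↭σx∷ys) (there z∈ys)))
      ... | here σz≈x =
        ⊥-elim (All[≉]⇒∉ S σx≉ys (∈-resp-≈ S (trans (sym (σ-involutive z)) (σ-cong σz≈x)) z∈ys))
      ... | there σz∈xs with ∈-resp-↭ xs↭σx∷ys σz∈xs
      ...   | here σz≈σx =
        ⊥-elim (All[≉]⇒∉ S x≉xs (∈-resp-≈ S z≈x (∈-resp-↭ (↭-sym xs↭σx∷ys) (there z∈ys))))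
        where
        z≈x : z ≈ x
        z≈x = trans (sym (σ-involutive z)) (trans (σ-cong σz≈σx) (σ-involutive x))
      ...   | there σz∈ys = σz∈ys

2∣n⊎2∣1+n : ∀ n → 2 ∣ n ⊎ 2 ∣ suc n
2∣n⊎2∣1+n zero    = inj₁ (2 ∣0)
2∣n⊎2∣1+n (suc n) = Sum.swap (Sum.map₁ (∣m∣n⇒∣m+n ∣-refl) (2∣n⊎2∣1+n n))

odd<odd⇒≤∸2 : ∀ {j q} → j < q → ¬ 2 ∣ j → ¬ 2 ∣ q → j ≤ q ∸ 2
odd<odd⇒≤∸2 {j} {suc q} (s≤s j≤q) 2∤j 2∤1+q with j ℕ.≟ q
... | yes ≡.refl = ⊥-elim (Sum.[ 2∤j , 2∤1+q ] (2∣n⊎2∣1+n j))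
... | no j≢q     = <⇒≤pred (≤∧≢⇒< j≤q j≢q)

≤∸1⇒< : ∀ {m q} → 1 ≤ m → m ≤ q ∸ 1 → m < q
≤∸1⇒< {q = zero}  (s≤s _) ()
≤∸1⇒< {q = suc q} _       m≤q = s≤s m≤q

module _ {c ℓ : Level} (F : FiniteField c ℓ) where
  open FiniteField F hiding (zero)
  open import Relation.Binary.Reasoning.Setoid setoid
  open UniqueS using (Unique)
  open import Algebra.Properties.Ring ring using (-1*x≈-x; -‿distribˡ-*)
  open import Algebra.Properties.Group +-group
    using (//-rightDividesˡ; identityʳ-unique; inverseʳ-unique; ⁻¹-involutive; x∙y⁻¹≈ε⇒x≈y)
  open import Algebra.Properties.CommutativeSemigroup *-commutativeSemigroup
    using (interchange; x∙yz≈y∙xz; x∙yz≈xz∙y)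
  open import Algebra.Properties.Semiring.Sum semiring
    using (sum; sum-cong-≋; sum-cong-≗; ∑-distrib-+; *-distribʳ-sum; *-distribˡ-sum; sum-remove; sum-replicate-zero)
  open import Algebra.Solver.Ring.NaturalCoefficients.Default commutativeSemiring

  x*y≈0⇒y≈0 : ∀ {x y} → x * y ≈ 0# → ¬ x ≈ 0# → y ≈ 0#
  x*y≈0⇒y≈0 {x} {y} xy≈0 x≉0 with inverse x x≉0
  ... | x⁻¹ , xx⁻¹≈1 = begin
    y              ≈⟨ *-identityˡ y ⟨
    1# * y         ≈⟨ *-congʳ (trans (*-comm x⁻¹ x) xx⁻¹≈1) ⟨
    (x⁻¹ * x) * y  ≈⟨ *-assoc x⁻¹ x y ⟩
    x⁻¹ * (x * y)  ≈⟨ *-congˡ xy≈0 ⟩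
    x⁻¹ * 0#       ≈⟨ zeroʳ x⁻¹ ⟩
    0#             ∎

  1+1≉0 : ¬ 2 ∣ size → ¬ 1# + 1# ≈ 0#
  1+1≉0 q-odd 1+1≈0 = q-odd (even-length-closed setoid (_+ 1#) +-congʳ +1-involutive +1-fixpoint-free
                                                   size ≡.refl distinct (λ {x} _ → complete (x + 1#)))
    where
    +1-involutive : ∀ x → (x + 1#) + 1# ≈ x
    +1-involutive x = trans (+-assoc x 1# 1#) (trans (+-congˡ 1+1≈0) (+-identityʳ x))
    +1-fixpoint-free : ∀ x → ¬ x + 1# ≈ x
    +1-fixpoint-free x x+1≈x = 1≉0 (identityʳ-unique x 1# x+1≈x)

  pow-cong : ∀ {x y} k → x ≈ y → pow F x k ≈ pow F y k
  pow-cong zero    _   = refl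
  pow-cong (suc k) x≈y = *-cong x≈y (pow-cong k x≈y)

  pow-* : ∀ x y k → pow F (x * y) k ≈ pow F x k * pow F y k
  pow-* x y zero    = sym (*-identityˡ 1#)
  pow-* x y (suc k) = trans (*-congˡ (pow-* x y k)) (interchange x y (pow F x k) (pow F y k))

  pow≉0 : ∀ {x} k → ¬ x ≈ 0# → ¬ pow F x k ≈ 0#
  pow≉0 zero    _   1≈0  = 1≉0 1≈0
  pow≉0 (suc k) x≉0 xxᵏ≈0 = pow≉0 k x≉0 (x*y≈0⇒y≈0 xxᵏ≈0 x≉0)

  pow-≈0 : ∀ {x} k → x ≈ 0# → 1 ≤ k → pow F x k ≈ 0#
  pow-≈0 (suc k) x≈0 _ = trans (*-congʳ x≈0) (zeroˡ _)

  pow-neg : ∀ x k → pow F (- x) k ≈ pow F (- 1#) k * pow F x k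
  pow-neg x k = trans (pow-cong k (sym (-1*x≈-x x))) (pow-* (- 1#) x k)

  pow-neg-one-even : ∀ q → pow F (- 1#) (q ℕ.* 2) ≈ 1#
  pow-neg-one-even zero    = refl
  pow-neg-one-even (suc q) = begin
    - 1# * (- 1# * pow F (- 1#) (q ℕ.* 2))  ≈⟨ *-assoc _ _ _ ⟨
    (- 1# * - 1#) * pow F (- 1#) (q ℕ.* 2)  ≈⟨ *-cong (trans (-1*x≈-x (- 1#)) (⁻¹-involutive 1#))
                                                      (pow-neg-one-even q) ⟩
    1# * 1#                                 ≈⟨ *-identityˡ 1# ⟩
    1#                                      ∎

  eval : ∀ {n} → Vector Carrier n → Carrier → Carrier
  eval c y = sum (λ j → c j * pow F y (toℕ j))

  eval-cong : ∀ {n} (c : Vector Carrier n) {y y′} → y ≈ y′ → eval c y ≈ eval c y′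
  eval-cong {n} c y≈y′ = sum-cong-≋ {n} (λ j → *-congˡ (pow-cong (toℕ j) y≈y′))

  eval-+ : ∀ {n} (c d : Vector Carrier n) y → eval (λ j → c j + d j) y ≈ eval c y + eval d y
  eval-+ {n} c d y = trans (sum-cong-≋ {n} (λ j → distribʳ _ (c j) (d j))) (∑-distrib-+ {n} _ _)

  eval-∷ : ∀ {n} (c : Vector Carrier (suc n)) y → eval c y ≈ head c + y * eval (tail c) y
  eval-∷ {n} c y = +-cong (*-identityʳ (head c)) (begin
    sum (λ j → c (suc j) * (y * pow F y (toℕ j)))  ≈⟨ sum-cong-≋ {n} (λ j → x∙yz≈y∙xz (c (suc j)) y _) ⟩
    sum (λ j → y * (c (suc j) * pow F y (toℕ j)))  ≈⟨ *-distribˡ-sum {n} y _ ⟨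
    y * eval (tail c) y                            ∎)

  eval-0≈head : ∀ {n} (c : Vector Carrier (suc n)) → eval c 0# ≈ head c
  eval-0≈head c = trans (eval-∷ c 0#) (trans (+-congˡ (zeroˡ _)) (+-identityʳ (head c)))

  eval-0≈coefficient : ∀ {n} (c : Vector Carrier n) i → toℕ i ≡ 0 → eval c 0# ≈ c i
  eval-0≈coefficient c zero _ = eval-0≈head c

  sum-single : ∀ {n} (t : Vector Carrier n) i → (∀ j → j ≢ i → t j ≈ 0#) → sum t ≈ t i
  sum-single {suc n} t i t≈0 = begin
    sum t                          ≈⟨ sum-remove {i = i} t ⟩
    t i + sum (Vec.removeAt t i)   ≈⟨ +-congˡ (sum-cong-≋ {n} (λ j → t≈0 (punchIn i j) (punchInᵢ≢i i j))) ⟩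
    t i + sum (Vec.replicate n 0#) ≈⟨ +-congˡ (sum-replicate-zero n) ⟩
    t i + 0#                       ≈⟨ +-identityʳ (t i) ⟩
    t i                            ∎

  monomial : ∀ {n} → Fin n → Carrier → Vector Carrier n
  monomial i a = Vec.updateAt (Vec.replicate _ 0#) i (λ _ → a)

  eval-monomial : ∀ {n} (i : Fin n) a y → eval (monomial i a) y ≈ a * pow F y (toℕ i)
  eval-monomial i a y = trans (sum-single _ i elsewhere≈0) (*-congʳ (reflexive (updateAt-updates i _)))
    where
    elsewhere≈0 : ∀ j → j ≢ i → monomial i a j * pow F y (toℕ j) ≈ 0#
    elsewhere≈0 j j≢i = trans (*-congʳ (reflexive (updateAt-minimal j i _ j≢i))) (zeroˡ _)

  quotient : ∀ {n} → Vector Carrier (suc n) → Carrier → Vector Carrier n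
  quotient {zero}  c r = Vec.[]
  quotient {suc n} c r = eval (tail c) r Vec.∷ quotient (tail c) r

  factor-theorem : ∀ {n} (c : Vector Carrier (suc n)) r y →
                   eval c y ≈ eval c r + (y - r) * eval (quotient c r) y
  factor-theorem {zero}  c r y = sym (trans (+-congˡ (zeroʳ (y - r))) (+-identityʳ _))
  factor-theorem {suc n} c r y = begin
    eval c y                                  ≈⟨ eval-∷ c y ⟩
    head c + y * eval (tail c) y              ≈⟨ +-congˡ (*-congˡ (factor-theorem (tail c) r y)) ⟩
    head c + y * (T + (y - r) * Q)            ≈⟨ regroup (head c) y r T Q ⟩
    (head c + r * T) + (y - r) * (T + y * Q)  ≈⟨ +-cong (eval-∷ c r) (*-congˡ (eval-∷ (quotient c r) y)) ⟨
    eval c r + (y - r) * eval (quotient c r) y ∎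
    where
    T Q : Carrier
    T = eval (tail c) r
    Q = eval (quotient (tail c) r) y
    regroup : ∀ a y r T Q → a + y * (T + (y - r) * Q) ≈ (a + r * T) + (y - r) * (T + y * Q)
    regroup a y r T Q = begin
      a + y * (T + (y - r) * Q)                     ≈⟨ +-identityʳ _ ⟨
      a + y * (T + (y - r) * Q) + 0#                ≈⟨ +-congˡ (trans (*-congˡ (-‿inverseʳ r)) (zeroʳ T)) ⟨
      a + y * (T + (y - r) * Q) + T * (r - r)       ≈⟨ expand a y r (- r) T Q ⟩
      (a + r * T) + (y - r) * (T + y * Q)           ∎
      where
      -- The solver has natural-number coefficients, so − r enters as an independent atom r′.
      expand : ∀ a y r r′ T Q → a + y * (T + (y + r′) * Q) + T * (r + r′) ≈ (a + r * T) + (y + r′) * (T + y * Q)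
      expand = solve 6 (λ a y r r′ T Q → a :+ y :* (T :+ (y :+ r′) :* Q) :+ T :* (r :+ r′)
                                        := (a :+ r :* T) :+ (y :+ r′) :* (T :+ y :* Q)) refl

  head≈0 : ∀ {n} (c : Vector Carrier (suc n)) r → eval c r ≈ 0# → eval (tail c) r ≈ 0# → head c ≈ 0#
  head≈0 c r cr≈0 tr≈0 = begin
    head c                       ≈⟨ +-identityʳ (head c) ⟨
    head c + 0#                  ≈⟨ +-congˡ (trans (*-congˡ tr≈0) (zeroʳ r)) ⟨
    head c + r * eval (tail c) r ≈⟨ eval-∷ c r ⟨
    eval c r                     ≈⟨ cr≈0 ⟩
    0#                           ∎

  quotient≈0⇒≈0 : ∀ {n} (c : Vector Carrier (suc n)) r → eval c r ≈ 0# →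
                  (∀ j → quotient c r j ≈ 0#) → ∀ j → c j ≈ 0#
  quotient≈0⇒≈0 {zero}  c r cr≈0 _   zero    = head≈0 c r cr≈0 refl
  quotient≈0⇒≈0 {zero}  c r cr≈0 _   (suc ())
  quotient≈0⇒≈0 {suc n} c r cr≈0 q≈0 zero    = head≈0 c r cr≈0 (q≈0 zero)
  quotient≈0⇒≈0 {suc n} c r cr≈0 q≈0 (suc j) = quotient≈0⇒≈0 (tail c) r (q≈0 zero) (q≈0 ∘ suc) j

  roots⇒coefficients≈0 : ∀ {n} (c : Vector Carrier n) {ys} → Unique setoid ys → n ≤ length ys →
                         All (λ y → eval c y ≈ 0#) ys → ∀ j → c j ≈ 0#
  roots⇒coefficients≈0 {suc n} c {r ∷ ys} (r≉ys ∷ !ys) (s≤s n≤|ys|) (cr≈0 ∷ cys≈0) =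
    quotient≈0⇒≈0 c r cr≈0 (roots⇒coefficients≈0 (quotient c r) !ys n≤|ys| (All.zipWith root (r≉ys , cys≈0)))
    where
    root : ∀ {y} → ¬ r ≈ y × eval c y ≈ 0# → eval (quotient c r) y ≈ 0#
    root {y} (r≉y , cy≈0) = x*y≈0⇒y≈0 (begin
      (y - r) * eval (quotient c r) y            ≈⟨ +-identityˡ _ ⟨
      0# + (y - r) * eval (quotient c r) y       ≈⟨ +-congʳ cr≈0 ⟨
      eval c r + (y - r) * eval (quotient c r) y ≈⟨ factor-theorem c r y ⟨
      eval c y                                   ≈⟨ cy≈0 ⟩
      0#                                         ∎) (r≉y ∘ sym ∘ x∙y⁻¹≈ε⇒x≈y y r)

  eval≈0⇒coefficients≈0 : ∀ {n} (c : Vector Carrier n) → n ≤ size →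
                          (∀ y → eval c y ≈ 0#) → ∀ j → c j ≈ 0#
  eval≈0⇒coefficients≈0 c n≤q c≈0 = roots⇒coefficients≈0 c distinct n≤q (All.tabulate (λ {y} _ → c≈0 y))

  eval-constant⇒coefficients≈0 : ∀ {n} (c : Vector Carrier n) → n ≤ size → (∀ x → eval c x ≈ eval c 0#) →
                                 ∀ i → toℕ i ≢ 0 → c i ≈ 0#
  eval-constant⇒coefficients≈0 c       _   _       zero    i≢0 = ⊥-elim (i≢0 ≡.refl)
  eval-constant⇒coefficients≈0 {suc n} c n≤q c-const (suc i) _  =
    eval≈0⇒coefficients≈0 (0# Vec.∷ tail c) n≤q shifted≈0 (suc i)
    where
    shifted≈0 : ∀ x → eval (0# Vec.∷ tail c) x ≈ 0#
    shifted≈0 x = begin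
      eval (0# Vec.∷ tail c) x  ≈⟨ eval-∷ (0# Vec.∷ tail c) x ⟩
      0# + x * eval (tail c) x  ≈⟨ +-identityˡ _ ⟩
      x * eval (tail c) x       ≈⟨ identityʳ-unique (head c) _ (begin
        head c + x * eval (tail c) x  ≈⟨ eval-∷ c x ⟨
        eval c x                      ≈⟨ c-const x ⟩
        eval c 0#                     ≈⟨ eval-0≈head c ⟩
        head c                        ∎) ⟩
      0#                        ∎

  eval-odd⇒even-coefficients≈0 : ¬ 1# + 1# ≈ 0# → ∀ {n} (c : Vector Carrier n) → n ≤ size →
                                 (∀ y → eval c y + eval c (- y) ≈ 0#) → ∀ j → 2 ∣ toℕ j → c j ≈ 0#
  eval-odd⇒even-coefficients≈0 2≉0 {n} c n≤q c-odd j (divides k j≡k*2) =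
    x*y≈0⇒y≈0 (begin
      (1# + 1#) * c j                     ≈⟨ distribʳ (c j) 1# 1# ⟩
      1# * c j + 1# * c j                 ≈⟨ +-cong (*-identityˡ _) (trans (*-identityˡ _) (sym (*-identityʳ _))) ⟩
      c j + c j * 1#                      ≈⟨ +-congˡ (*-congˡ (pow-neg-one-even k)) ⟨
      c j + c j * pow F (- 1#) (k ℕ.* 2)  ≈⟨ +-congˡ (*-congˡ (reflexive (≡.cong (pow F (- 1#)) j≡k*2))) ⟨
      symmetrised j                       ≈⟨ eval≈0⇒coefficients≈0 symmetrised n≤q symmetrised≈0 j ⟩
      0#                                  ∎) 2≉0
    where
    symmetrised : Vector Carrier n
    symmetrised i = c i + c i * pow F (- 1#) (toℕ i)
    symmetrised≈0 : ∀ y → eval symmetrised y ≈ 0#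
    symmetrised≈0 y = begin
      eval symmetrised y
        ≈⟨ eval-+ c (λ i → c i * pow F (- 1#) (toℕ i)) y ⟩
      eval c y + eval (λ i → c i * pow F (- 1#) (toℕ i)) y
        ≈⟨ +-congˡ (sum-cong-≋ {n} (λ i → trans (*-assoc _ _ _) (*-congˡ (sym (pow-neg y (toℕ i)))))) ⟩
      eval c y + eval c (- y)
        ≈⟨ c-odd y ⟩
      0# ∎

  pow-identity⇒≈0 : ∀ {a m n} → m ≢ n → m < size → n < size →
                    (∀ y → pow F a m * pow F y n ≈ pow F y m * pow F a n) → a ≈ 0#
  pow-identity⇒≈0 {a} {m} {n} m≢n m<q n<q identity =
    decidable-stable (a ≟ 0#) (λ a≉0 → pow≉0 m a≉0 aᵐ≈0)
    where
    aᵐ aⁿ : Carrier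
    aᵐ = pow F a m
    aⁿ = pow F a n
    iₘ iₙ : Fin size
    iₘ = fromℕ< m<q
    iₙ = fromℕ< n<q
    binomial : Vector Carrier size
    binomial j = monomial iₙ aᵐ j + monomial iₘ (- aⁿ) j
    binomial≈0 : ∀ y → eval binomial y ≈ 0#
    binomial≈0 y = begin
      eval binomial y
        ≈⟨ eval-+ (monomial iₙ aᵐ) (monomial iₘ (- aⁿ)) y ⟩
      eval (monomial iₙ aᵐ) y + eval (monomial iₘ (- aⁿ)) y
        ≈⟨ +-cong (eval-monomial iₙ aᵐ y) (eval-monomial iₘ (- aⁿ) y) ⟩
      aᵐ * pow F y (toℕ iₙ) + - aⁿ * pow F y (toℕ iₘ)
        ≈⟨ +-cong (*-congˡ (yᵏ n<q)) (*-congˡ (yᵏ m<q)) ⟩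
      aᵐ * pow F y n + - aⁿ * pow F y m
        ≈⟨ +-cong (identity y) (trans (sym (-‿distribˡ-* aⁿ _)) (-‿cong (*-comm aⁿ _))) ⟩
      pow F y m * aⁿ - pow F y m * aⁿ
        ≈⟨ -‿inverseʳ _ ⟩
      0# ∎
      where
      yᵏ : ∀ {k} (k<q : k < size) → pow F y (toℕ (fromℕ< k<q)) ≈ pow F y k
      yᵏ k<q = reflexive (≡.cong (pow F y) (toℕ-fromℕ< k<q))
    aᵐ≈0 : aᵐ ≈ 0#
    aᵐ≈0 = begin
      aᵐ           ≈⟨ +-identityʳ aᵐ ⟨
      aᵐ + 0#      ≈⟨ +-cong (reflexive (updateAt-updates iₙ _))
                             (reflexive (updateAt-minimal iₙ iₘ _ (m≢n ∘ ≡.sym ∘ fromℕ<-injective _ _ n<q m<q))) ⟨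
      binomial iₙ  ≈⟨ eval≈0⇒coefficients≈0 binomial ≤-refl binomial≈0 iₙ ⟩
      0#           ∎

  sumFin≡sum : ∀ {n} (h : Vector Carrier n) → sumFin F h ≡ sum h
  sumFin≡sum h = ≡.trans (≡.cong (List.foldr _+_ 0#) (map-tabulate id h)) (foldr-tabulate h)
    where
    foldr-tabulate : ∀ {n} (h : Vector Carrier n) → List.foldr _+_ 0# (List.tabulate h) ≡ sum h
    foldr-tabulate {zero}  h = ≡.refl
    foldr-tabulate {suc n} h = ≡.cong (h zero +_) (foldr-tabulate (tail h))

  eval2≈eval∘eval : ∀ (p : Poly2 F) x y → eval2 F p x y ≈ eval (λ i → eval (p i) y) x
  eval2≈eval∘eval p x y = begin
    eval2 F p x y
      ≈⟨ reflexive (≡.trans (sumFin≡sum {size} _) (sum-cong-≗ {size} (λ i → sumFin≡sum {size} _))) ⟩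
    sum (λ i → sum (λ j → p i j * (pow F x (toℕ i) * pow F y (toℕ j))))
      ≈⟨ sum-cong-≋ {size} (λ i → trans (sum-cong-≋ {size} (λ j → x∙yz≈xz∙y (p i j) _ _))
                                         (sym (*-distribʳ-sum {size} _ _))) ⟩
    eval (λ i → eval (p i) y) x ∎

  eval2-cong : ∀ (p : Poly2 F) {x x′ y y′} → x ≈ x′ → y ≈ y′ → eval2 F p x y ≈ eval2 F p x′ y′
  eval2-cong p {x} {x′} {y} {y′} x≈x′ y≈y′ = begin
    eval2 F p x y                 ≈⟨ eval2≈eval∘eval p x y ⟩
    eval (λ i → eval (p i) y) x   ≈⟨ eval-cong (λ i → eval (p i) y) x≈x′ ⟩
    eval (λ i → eval (p i) y) x′  ≈⟨ sum-cong-≋ {size} (λ i → *-congʳ (eval-cong (p i) y≈y′)) ⟩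
    eval (λ i → eval (p i) y′) x′ ≈⟨ eval2≈eval∘eval p x′ y′ ⟨
    eval2 F p x′ y′               ∎

  coefficients-of-x-free-odd : ¬ 2 ∣ size → (g : Poly2 F) →
    (∀ x y → eval2 F g x y ≈ eval2 F g 0# y) → (∀ y → eval2 F g 0# y + eval2 F g 0# (- y) ≈ 0#) →
    ∀ i j → (toℕ i ≡ 0 × ¬ 2 ∣ toℕ j × toℕ j ≤ size ∸ 2) ⊎ (g i j ≈ 0#)
  coefficients-of-x-free-odd q-odd g x-free odd i j with toℕ i ℕ.≟ 0 | 2 ∣? toℕ j
  ... | no i≢0  | _       = inj₂ (eval≈0⇒coefficients≈0 (g i) ≤-refl gᵢ≈0 j)
    where
    gᵢ≈0 : ∀ y → eval (g i) y ≈ 0#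
    gᵢ≈0 y = eval-constant⇒coefficients≈0 (λ i → eval (g i) y) ≤-refl (λ x → begin
      eval (λ i → eval (g i) y) x   ≈⟨ eval2≈eval∘eval g x y ⟨
      eval2 F g x y                 ≈⟨ x-free x y ⟩
      eval2 F g 0# y                ≈⟨ eval2≈eval∘eval g 0# y ⟩
      eval (λ i → eval (g i) y) 0#  ∎) i i≢0
  ... | yes i≡0 | yes 2∣j = inj₂ (eval-odd⇒even-coefficients≈0 (1+1≉0 q-odd) (g i) ≤-refl gᵢ-odd j 2∣j)
    where
    g0≈gᵢ : ∀ y → eval2 F g 0# y ≈ eval (g i) y
    g0≈gᵢ y = trans (eval2≈eval∘eval g 0# y) (eval-0≈coefficient (λ i → eval (g i) y) i i≡0)
    gᵢ-odd : ∀ y → eval (g i) y + eval (g i) (- y) ≈ 0#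
    gᵢ-odd y = trans (sym (+-cong (g0≈gᵢ y) (g0≈gᵢ (- y)))) (odd y)
  ... | yes i≡0 | no 2∤j  = inj₁ (i≡0 , 2∤j , odd<odd⇒≤∸2 (toℕ<n j) 2∤j q-odd)

  infix 4 _≈²_
  _≈²_ : Vtx F → Vtx F → Set ℓ
  _≈²_ = _≈V_ F

  ≈²-sym : ∀ {u v} → u ≈² v → v ≈² u
  ≈²-sym (x≈x′ , y≈y′) = sym x≈x′ , sym y≈y′

  bijective-polyMap⇒IsPermPoly2 : ∀ (f g : Poly2 F) →
    (∀ u v → polyMap F f g u ≈² polyMap F f g v → u ≈² v) → (∀ w → ∃ λ u → polyMap F f g u ≈² w) →
    IsPermPoly2 F f × IsPermPoly2 F g
  bijective-polyMap⇒IsPermPoly2 f g φ-injective φ-surjective = f-perm , g-perm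
    where
    S² : Setoid c ℓ
    S² = setoid ×ₛ setoid
    φ : Vtx F → Vtx F
    φ = polyMap F f g
    V : List (Vtx F)
    V = cartesianProduct elements elements
    !V : Unique S² V
    !V = UniqueP.cartesianProduct⁺ setoid setoid distinct distinct
    V-complete : ∀ w → Membership._∈_ S² w V
    V-complete (x , y) = MembershipP.∈-cartesianProduct⁺ setoid setoid (complete x) (complete y)
    φ-cong : ∀ {u v} → u ≈² v → φ u ≈² φ v
    φ-cong (x≈x′ , y≈y′) = eval2-cong f x≈x′ y≈y′ , eval2-cong g x≈x′ y≈y′
    first≟ : ∀ α → Decidable₁ (λ (w : Vtx F) → proj₁ w ≈ α)
    first≟ α w = proj₁ w ≟ α
    first-resp : ∀ α {u v} → u ≈² v → proj₁ u ≈ α → proj₁ v ≈ α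
    first-resp α (x≈x′ , _) x≈α = trans (sym x≈x′) x≈α
    first-count : ∀ α → length (filter (first≟ α) V) ≡ size
    first-count α = ≡.trans (length-filter-proj₁-cartesianProduct (_≟ α) elements elements)
                            (≡.trans (≡.cong (ℕ._* size) (length-filter-≟-unique setoid _≟_ distinct (complete α)))
                                     (ℕP.*-identityˡ size))
    f-perm : IsPermPoly2 F f
    f-perm α = ≡.trans
      (length-filter-∘-bijection S² (first≟ α) (first-resp α) φ φ-cong φ-injective φ-surjective !V V-complete)
      (first-count α)
    g-perm : IsPermPoly2 F g
    g-perm α = ≡.trans
      (length-filter-∘-bijection S² (first≟ α ∘ swap) (first-resp α ∘ swap)
                                 φ φ-cong φ-injective φ-surjective !V V-complete)
      (≡.trans (length-filter-∘-bijection S² (first≟ α) (first-resp α)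
                                          swap swap (λ _ _ → swap) (λ w → swap w , refl , refl) !V V-complete)
               (first-count α))

  Arc-resp : ∀ m n {u u′ v v′} → u ≈² u′ → v ≈² v′ → Arc F m n u v → Arc F m n u′ v′
  Arc-resp m n (x≈x′ , y≈y′) (z≈z′ , w≈w′) arc =
    trans (sym (+-cong y≈y′ w≈w′)) (trans arc (*-cong (pow-cong m x≈x′) (pow-cong n z≈z′)))

  IsSymmetric : ℕ → ℕ → Vtx F → Set (c ⊔ ℓ)
  IsSymmetric m n u = ∀ v → Arc F m n u v → Arc F m n v u

  diagonal-symmetric : ∀ m u → IsSymmetric m m u
  diagonal-symmetric m (a , b) (y , z) arc = trans (+-comm z b) (trans arc (*-comm _ _))

  axis-symmetric : ∀ {m n} → 1 ≤ m → 1 ≤ n → ∀ {u} → proj₁ u ≈ 0# → IsSymmetric m n u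
  axis-symmetric {suc m} {suc n} _ _ {a , b} a≈0 (y , z) arc = begin
    z + b                           ≈⟨ +-comm z b ⟩
    b + z                           ≈⟨ arc ⟩
    a * pow F a m * pow F y (suc n) ≈⟨ trans (*-congʳ (pow-≈0 (suc m) a≈0 (s≤s z≤n))) (zeroˡ _) ⟩
    0#                              ≈⟨ trans (*-congˡ (pow-≈0 (suc n) a≈0 (s≤s z≤n))) (zeroʳ _) ⟨
    pow F y (suc m) * (a * pow F a n) ∎

  symmetric⇒on-axis : ∀ {m n} → m ≢ n → m < size → n < size → ∀ {u} → IsSymmetric m n u → proj₁ u ≈ 0#
  symmetric⇒on-axis {m} {n} m≢n m<q n<q {a , b} symmetric = pow-identity⇒≈0 m≢n m<q n<q (λ y → begin
    pow F a m * pow F y n              ≈⟨ //-rightDividesˡ b _ ⟨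
    (pow F a m * pow F y n - b) + b    ≈⟨ symmetric (y , pow F a m * pow F y n - b)
                                                  (trans (+-comm b _) (//-rightDividesˡ b _)) ⟩
    pow F y m * pow F a n              ∎)

  module Isomorphism {m₁ n₁ m₂ n₂ φ} (iso : IsDigraphIso F m₁ n₁ m₂ n₂ φ) where

    private
      arcs : ∀ u v → Arc F m₁ n₁ u v ⇔ Arc F m₂ n₂ (φ u) (φ v)
      arcs = proj₂ (proj₂ iso)

    iso-preserves-symmetric : ∀ {u} → IsSymmetric m₁ n₁ u → IsSymmetric m₂ n₂ (φ u)
    iso-preserves-symmetric {u} symmetric w arc with proj₁ (proj₂ iso) w
    ... | v , φv≈w = Arc-resp m₂ n₂ φv≈w (refl , refl) (Equivalence.to (arcs v u) (symmetric v arc′))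
      where
      arc′ : Arc F m₁ n₁ u v
      arc′ = Equivalence.from (arcs u v) (Arc-resp m₂ n₂ (refl , refl) (≈²-sym φv≈w) arc)

    iso-reflects-symmetric : ∀ {u} → IsSymmetric m₂ n₂ (φ u) → IsSymmetric m₁ n₁ u
    iso-reflects-symmetric {u} symmetric v arc =
      Equivalence.from (arcs v u) (symmetric (φ v) (Equivalence.to (arcs u v) arc))

  module MonomialDigraphIso {m₁ n₁ m₂ n₂ : ℕ}
    (1≤m₁ : 1 ≤ m₁) (m₁<q : m₁ < size) (1≤n₁ : 1 ≤ n₁) (n₁<q : n₁ < size)
    (1≤m₂ : 1 ≤ m₂) (m₂<q : m₂ < size) (1≤n₂ : 1 ≤ n₂) (n₂<q : n₂ < size)
    (f g : Poly2 F) (iso : IsDigraphIso F m₁ n₁ m₂ n₂ (polyMap F f g)) (m₁≢n₁ : m₁ ≢ n₁) where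

    private
      φ : Vtx F → Vtx F
      φ = polyMap F f g
    open Isomorphism {m₁} {n₁} {m₂} {n₂} {φ} iso

    m₂≢n₂ : m₂ ≢ n₂
    m₂≢n₂ ≡.refl = 1≉0 (symmetric⇒on-axis m₁≢n₁ m₁<q n₁<q {1# , 0#}
                          (iso-reflects-symmetric {1# , 0#} (diagonal-symmetric m₂ (φ (1# , 0#)))))

    f≈0⇔x≈0 : ∀ x y → eval2 F f x y ≈ 0# ⇔ x ≈ 0#
    f≈0⇔x≈0 x y = mk⇔
      (λ f≈0 → symmetric⇒on-axis m₁≢n₁ m₁<q n₁<q
                 (iso-reflects-symmetric {x , y} (axis-symmetric 1≤m₂ 1≤n₂ f≈0)))
      (λ x≈0 → symmetric⇒on-axis m₂≢n₂ m₂<q n₂<q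
                 (iso-preserves-symmetric {x , y} (axis-symmetric 1≤m₁ 1≤n₁ x≈0)))

    g≈-g[0,-y] : ∀ x y → eval2 F g x y ≈ - eval2 F g 0# (- y)
    g≈-g[0,-y] x y = inverseʳ-unique _ _ (begin
      eval2 F g 0# (- y) + eval2 F g x y
        ≈⟨ Equivalence.to (proj₂ (proj₂ iso) (0# , - y) (x , y)) arc ⟩
      pow F (eval2 F f 0# (- y)) m₂ * pow F (eval2 F f x y) n₂
        ≈⟨ *-congʳ (pow-≈0 m₂ (Equivalence.from (f≈0⇔x≈0 0# (- y)) refl) 1≤m₂) ⟩
      0# * pow F (eval2 F f x y) n₂
        ≈⟨ zeroˡ _ ⟩
      0# ∎)
      where
      arc : Arc F m₁ n₁ (0# , - y) (x , y)
      arc = trans (-‿inverseˡ y) (sym (trans (*-congʳ (pow-≈0 m₁ refl 1≤m₁)) (zeroˡ _)))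

    g-x-free : ∀ x y → eval2 F g x y ≈ eval2 F g 0# y
    g-x-free x y = trans (g≈-g[0,-y] x y) (sym (g≈-g[0,-y] 0# y))

    g-odd : ∀ y → eval2 F g 0# y + eval2 F g 0# (- y) ≈ 0#
    g-odd y = trans (+-congʳ (g≈-g[0,-y] 0# y)) (-‿inverseˡ _)

    g-bijective : IsBijection1 F (λ y → eval2 F g 0# y)
    g-bijective = injective , surjective
      where
      f[0,y]≈0 : ∀ y → eval2 F f 0# y ≈ 0#
      f[0,y]≈0 y = Equivalence.from (f≈0⇔x≈0 0# y) refl
      injective : ∀ y y′ → eval2 F g 0# y ≈ eval2 F g 0# y′ → y ≈ y′
      injective y y′ g≈g′ =
        proj₂ (proj₁ iso (0# , y) (0# , y′) (trans (f[0,y]≈0 y) (sym (f[0,y]≈0 y′)) , g≈g′))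
      surjective : ∀ z → ∃ λ y → eval2 F g 0# y ≈ z
      surjective z with proj₁ (proj₂ iso) (0# , z)
      ... | (x , y) , (_ , g≈z) = y , trans (sym (g-x-free x y)) g≈z

theorem4 : {c ℓ : Level} (F : FiniteField c ℓ) →
    let open FiniteField F in
    ¬ (2 ∣ size) →
    (m₁ n₁ m₂ n₂ : ℕ) →
    1 ≤ m₁ → m₁ ≤ size ∸ 1 → 1 ≤ n₁ → n₁ ≤ size ∸ 1 →
    1 ≤ m₂ → m₂ ≤ size ∸ 1 → 1 ≤ n₂ → n₂ ≤ size ∸ 1 →
    (f g : Poly2 F) →
    IsDigraphIso F m₁ n₁ m₂ n₂ (polyMap F f g) →
    (IsPermPoly2 F f × IsPermPoly2 F g)
    × (m₁ ≢ n₁ → ∀ x y → (eval2 F f x y ≈ 0#) ⇔ (x ≈ 0#))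
    × (m₁ ≢ n₁ →
        (∀ i j → (toℕ i ≡ 0 × ¬ (2 ∣ toℕ j) × toℕ j ≤ size ∸ 2) ⊎ (g i j ≈ 0#))
        × IsBijection1 F (λ y → eval2 F g 0# y))
theorem4 F q-odd m₁ n₁ m₂ n₂ 1≤m₁ m₁≤ 1≤n₁ n₁≤ 1≤m₂ m₂≤ 1≤n₂ n₂≤ f g iso =
  bijective-polyMap⇒IsPermPoly2 F f g (proj₁ iso) (proj₁ (proj₂ iso)) ,
  Iso.f≈0⇔x≈0 ,
  λ m₁≢n₁ → coefficients-of-x-free-odd F q-odd g (Iso.g-x-free m₁≢n₁) (Iso.g-odd m₁≢n₁) ,
            Iso.g-bijective m₁≢n₁
  where
  module Iso = MonomialDigraphIso F 1≤m₁ (≤∸1⇒< 1≤m₁ m₁≤) 1≤n₁ (≤∸1⇒< 1≤n₁ n₁≤)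
                                    1≤m₂ (≤∸1⇒< 1≤m₂ m₂≤) 1≤n₂ (≤∸1⇒< 1≤n₂ n₂≤) f g iso
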